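{- Let $v\in S_n$ avoid $2143$. Then $\Gamma_{[v,w_0]}$ contains no square region of size $3\times 3$ if and only if $v$ avoids $123$, $1432$ and $3214$.
   Context: $S_n$ in one-line notation, Bruhat order, $w_0$ the longest element. $\Gamma_{[v,w_0]}:=\{(i,u_i): u\geq v,\ i\in[n]\}\subseteq[n]^2$ with $(i,j)$ = row $i$, column $j$. A square region of size $3\times3$ is a set $[a,a+2]\times[b,b+2]\subseteq[n]^2$. Pattern avoidance is the usual notion. -}

module Defs where

open import Data.Nat using (ℕ; suc; _+_) renaming (_<_ to _<ℕ_)
open import Data.Fin using (Fin; toℕ; opposite; _<_)
open import Data.Fin.Permutation using (Permutation′; _⟨$⟩ʳ_)
import Data.Fin.Permutation.Components as PC
open import Data.Vec using (Vec; lookup; []; _∷_)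
open import Data.Product using (Σ; ∃; _×_; _,_)
open import Function.Bundles using (_⇔_)
open import Relation.Binary.PropositionalEquality using (_≡_)
open import Relation.Binary.Construct.Closure.ReflexiveTransitive using (Star)
open import Relation.Nullary using (¬_)

-- Permutations of [n] (0-indexed as Fin n); one-line notation u_i = u ⟨$⟩ʳ i.
Perm : ℕ → Set
Perm n = Permutation′ n

-- Bruhat covering-type step: w is obtained from u by swapping the entries
-- at positions i < j where u_i < u_j (i.e. w = u·t_{ij} with ℓ(w) > ℓ(u)).
BruhatStep : ∀ {n} → Perm n → Perm n → Set
BruhatStep {n} u w =
  Σ (Fin n) λ i → Σ (Fin n) λ j →
    (i < j) × ((u ⟨$⟩ʳ i) < (u ⟨$⟩ʳ j)) ×
    (∀ k → (w ⟨$⟩ʳ k) ≡ (u ⟨$⟩ʳ PC.transpose i j k))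

_≤B_ : ∀ {n} → Perm n → Perm n → Set
_≤B_ = Star BruhatStep

-- Longest element w0 : i ↦ n+1-i (0-indexed: i ↦ n-1-i).
w₀ : ∀ {n} → Perm n → Set
w₀ {n} w = ∀ i → (w ⟨$⟩ʳ i) ≡ opposite i

-- Γ_[v,w0] = {(i, u_i) : v ≤ u ≤ w0}; membership of (r , c).
InΓ : ∀ {n} → Perm n → Fin n → Fin n → Set
InΓ {n} v r c = Σ (Perm n) λ u → Σ (Perm n) λ w →
  w₀ w × (v ≤B u) × (u ≤B w) × ((u ⟨$⟩ʳ r) ≡ c)

HasSquare3 : ∀ {n} → Perm n → Set
HasSquare3 {n} v = Σ (Fin n) λ a → Σ (Fin n) λ b →
  (toℕ a + 2 <ℕ n) × (toℕ b + 2 <ℕ n) ×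
  (∀ (r c : Fin n) → toℕ a Data.Nat.≤ toℕ r → toℕ r Data.Nat.≤ toℕ a + 2 →
                     toℕ b Data.Nat.≤ toℕ c → toℕ c Data.Nat.≤ toℕ b + 2 →
                     InΓ v r c)

-- Pattern containment: the pattern p (in one-line notation, entries 1..k)
-- occurs in v at positions f(0) < … < f(k-1).
Contains : ∀ {n k} → Perm n → Vec ℕ k → Set
Contains {n} {k} v p = Σ (Fin k → Fin n) λ f →
  (∀ a b → a < b → f a < f b) ×
  (∀ a b → ((v ⟨$⟩ʳ f a) < (v ⟨$⟩ʳ f b)) ⇔ (lookup p a <ℕ lookup p b))

Avoids : ∀ {n k} → Perm n → Vec ℕ k → Set
Avoids v p = ¬ Contains v p

module Submission where

-- 1. Cells of Γ.  (r , c) ∈ Γ_[v,w₀] iff v has a point weakly north-west of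
--    (r , c) and one weakly south-east of it.  Necessity (Γ⇒NW, Γ⇒SE): a
--    Bruhat step u → u·(i j) only spreads points apart, so such witnesses
--    pass from any u ≥ v down to v.  Sufficiency (Γ-cell): with the
--    witnesses, at most two Bruhat steps bring the value c into row r
--    (reach), and every permutation lies below w₀ (below-w₀: fill in the
--    rows of w₀ from the top, one transposition at a time).
-- 2. Squares (squares-are-straddles).  Consequently Γ has a 3×3 square iff
--    v has two points at least two apart in rows and columns, iff v
--    straddles: there are rows i < j < k and a point p with v_i < v_p < v_k.
-- 3. Patterns.  Each of 123, 1432, 3214 straddles.  Conversely
--    (straddle-forces-pattern), in a straddle without 123 the value of row j
--    lies outside (v_i , v_k) and the row of p outside (i , k); the four
--    resulting configurations are occurrences of 3214, 2143, 2143 and 1432.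
-- The theorem combines 2 and 3.

open import Defs
open import Data.Nat using (ℕ)
open import Data.Vec using (Vec; []; _∷_)
open import Data.Product using (_×_)
open import Function.Bundles using (_⇔_)
open import Relation.Nullary using (¬_)

open import Data.Nat as ℕ using (suc; _+_; s≤s; z<s; s<s)
import Data.Nat.Properties as ℕ
open import Data.Fin using (Fin; toℕ; fromℕ<; opposite; _<_; _≤_)
import Data.Fin.Properties as FinP
open import Data.Fin.Patterns using (0F; 1F; 2F; 3F)
open import Data.Fin.Permutation using (_⟨$⟩ʳ_; _⟨$⟩ˡ_; _∘ₚ_; transpose; inverseʳ)
import Data.Fin.Permutation.Components as PC
open import Data.Vec using (lookup; map)
open import Data.Vec.Properties using (lookup-map)
open import Data.Vec.Relation.Unary.Linked using (Linked; [-]; _∷_)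
open import Data.Vec.Relation.Unary.Linked.Properties using (lookup⁺)
open import Data.Product using (∃; _,_)
open import Data.Sum using (_⊎_; inj₁; inj₂)
open import Data.Empty using (⊥-elim)
open import Function using (_∘_)
open import Function.Bundles using (Injection; Equivalence; mk⇔)
open import Function.Properties.Inverse using (↔⇒↣)
open import Relation.Binary.PropositionalEquality
open import Relation.Binary.Construct.Closure.ReflexiveTransitive using (ε; _◅_; _◅◅_)
open import Relation.Binary.Definitions using (tri<; tri≈; tri>)
open import Relation.Nullary using (Dec; yes; no)

private
  variable
    n k : ℕ
    u v w : Perm n
    p r c : Fin n

_<[_]_ : Fin n → Perm n → Fin n → Set
x <[ v ] y = v ⟨$⟩ʳ x < v ⟨$⟩ʳ y

perm-injective : (v : Perm n) {x y : Fin n} → v ⟨$⟩ʳ x ≡ v ⟨$⟩ʳ y → x ≡ y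
perm-injective v = Injection.injective (↔⇒↣ v)

two-apart : ∀ {x y z} → x ℕ.< y → y ℕ.< z → x + 2 ℕ.≤ z
two-apart {x} {y} {z} x<y y<z = subst (ℕ._≤ z) (ℕ.+-comm 2 x) (ℕ.≤-trans (s≤s x<y) y<z)

transpose-left : (i j : Fin n) → PC.transpose i j i ≡ j
transpose-left i j with i FinP.≟ i
... | yes _ = refl
... | no i≢i = ⊥-elim (i≢i refl)

transpose-right : (i j : Fin n) → PC.transpose i j j ≡ i
transpose-right i j with j FinP.≟ i
... | yes j≡i = j≡i
... | no _ with j FinP.≟ j
...   | yes _ = refl
...   | no j≢j = ⊥-elim (j≢j refl)

transpose-other : (i j x : Fin n) → x ≢ i → x ≢ j → PC.transpose i j x ≡ x
transpose-other i j x x≢i x≢j with x FinP.≟ i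
... | yes x≡i = ⊥-elim (x≢i x≡i)
... | no _ with x FinP.≟ j
...   | yes x≡j = ⊥-elim (x≢j x≡j)
...   | no _ = refl

transpose-cases : (i j x : Fin n) →
  (x ≡ i × PC.transpose i j x ≡ j) ⊎ (x ≡ j × PC.transpose i j x ≡ i) ⊎ PC.transpose i j x ≡ x
transpose-cases i j x = decide (x FinP.≟ i) (x FinP.≟ j)
  where
  decide : Dec (x ≡ i) → Dec (x ≡ j) →
    (x ≡ i × PC.transpose i j x ≡ j) ⊎ (x ≡ j × PC.transpose i j x ≡ i) ⊎ PC.transpose i j x ≡ x
  decide (yes x≡i) _ = inj₁ (x≡i , trans (cong (PC.transpose i j) x≡i) (transpose-left i j))
  decide (no _) (yes x≡j) = inj₂ (inj₁ (x≡j , trans (cong (PC.transpose i j) x≡j) (transpose-right i j)))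
  decide (no x≢i) (no x≢j) = inj₂ (inj₂ (transpose-other i j x x≢i x≢j))

-- u·(i j): the entries of u in rows i and j exchanged.
swap : Perm n → Fin n → Fin n → Perm n
swap u i j = transpose i j ∘ₚ u

swap-left : (u : Perm n) (i j : Fin n) → swap u i j ⟨$⟩ʳ i ≡ u ⟨$⟩ʳ j
swap-left u i j = cong (u ⟨$⟩ʳ_) (transpose-left i j)

swap-right : (u : Perm n) (i j : Fin n) → swap u i j ⟨$⟩ʳ j ≡ u ⟨$⟩ʳ i
swap-right u i j = cong (u ⟨$⟩ʳ_) (transpose-right i j)

swap-other : (u : Perm n) {i j x : Fin n} → x ≢ i → x ≢ j → swap u i j ⟨$⟩ʳ x ≡ u ⟨$⟩ʳ x
swap-other u {i} {j} {x} x≢i x≢j = cong (u ⟨$⟩ʳ_) (transpose-other i j x x≢i x≢j)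

swap-up : (u : Perm n) (i j : Fin n) → i < j → i <[ u ] j → u ≤B swap u i j
swap-up u i j i<j ui<uj = (i , j , i<j , ui<uj , λ _ → refl) ◅ ε

NW : Perm n → Fin n → Fin n → Set
NW {n} v r c = ∃ λ (x : Fin n) → x ≤ r × v ⟨$⟩ʳ x ≤ c

SE : Perm n → Fin n → Fin n → Set
SE {n} v r c = ∃ λ (x : Fin n) → r ≤ x × c ≤ v ⟨$⟩ʳ x

-- A Bruhat step u → w only spreads points apart: every point of w has a
-- point of u weakly north-west of it and one weakly south-east of it.
step-NW : BruhatStep u w → ∀ x → NW u x (w ⟨$⟩ʳ x)
step-NW (i , j , i<j , ui<uj , w≡) x rewrite w≡ x with transpose-cases i j x
... | inj₁ (refl , to-j) rewrite to-j = i , FinP.≤-refl , ℕ.<⇒≤ ui<uj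
... | inj₂ (inj₁ (refl , to-i)) rewrite to-i = i , ℕ.<⇒≤ i<j , FinP.≤-refl
... | inj₂ (inj₂ fixed) rewrite fixed = x , FinP.≤-refl , FinP.≤-refl

step-SE : BruhatStep u w → ∀ x → SE u x (w ⟨$⟩ʳ x)
step-SE (i , j , i<j , ui<uj , w≡) x rewrite w≡ x with transpose-cases i j x
... | inj₁ (refl , to-j) rewrite to-j = j , ℕ.<⇒≤ i<j , FinP.≤-refl
... | inj₂ (inj₁ (refl , to-i)) rewrite to-i = j , FinP.≤-refl , ℕ.<⇒≤ ui<uj
... | inj₂ (inj₂ fixed) rewrite fixed = x , FinP.≤-refl , FinP.≤-refl

NW-inherited : u ≤B w → NW w r c → NW u r c
NW-inherited ε nw = nw
NW-inherited {u = u} (_◅_ {j = m} s rest) nw with NW-inherited rest nw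
... | x , x≤r , mx≤c with step-NW {u = u} {w = m} s x
...   | y , y≤x , uy≤mx = y , FinP.≤-trans y≤x x≤r , FinP.≤-trans uy≤mx mx≤c

SE-inherited : u ≤B w → SE w r c → SE u r c
SE-inherited ε se = se
SE-inherited {u = u} (_◅_ {j = m} s rest) se with SE-inherited rest se
... | x , r≤x , c≤mx with step-SE {u = u} {w = m} s x
...   | y , x≤y , mx≤uy = y , FinP.≤-trans r≤x x≤y , FinP.≤-trans c≤mx mx≤uy

Γ⇒NW : InΓ v r c → NW v r c
Γ⇒NW {r = r} (_ , _ , _ , v≤u , _ , ur≡c) = NW-inherited v≤u (r , FinP.≤-refl , FinP.≤-reflexive ur≡c)

Γ⇒SE : InΓ v r c → SE v r c
Γ⇒SE {r = r} (_ , _ , _ , v≤u , _ , ur≡c) = SE-inherited v≤u (r , FinP.≤-refl , FinP.≤-reflexive (sym ur≡c))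

Reaches : Perm n → Fin n → Fin n → Set
Reaches {n} v r c = ∃ λ (u : Perm n) → v ≤B u × u ⟨$⟩ʳ r ≡ c

-- c sits in a row p below r: either swap rows r and p directly, or, if
-- v_r > c, pass c through the north-west witness row i < r (two steps).
reach-from-below : r < p → v ⟨$⟩ʳ p ≡ c → NW v r c → Reaches v r c
reach-from-below {n} {r = r} {p = p} {v = v} {c = c} r<p vp≡c (i , i≤r , vi≤c)
  with FinP.<-cmp (v ⟨$⟩ʳ r) c
... | tri≈ _ vr≡c _ = v , ε , vr≡c
... | tri< vr<c _ _ =
  swap v r p , swap-up v r p r<p (subst (v ⟨$⟩ʳ r <_) (sym vp≡c) vr<c) ,
  trans (swap-left v r p) vp≡c
... | tri> _ _ c<vr =
  swap u₁ i r , swap-up v i p i<p (subst (v ⟨$⟩ʳ i <_) (sym vp≡c) vi<c) ◅◅ swap-up u₁ i r i<r u₁i<u₁r ,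
  trans (swap-right u₁ i r) u₁i≡c
  where
  i<p : i < p
  i<p = ℕ.≤-<-trans i≤r r<p
  vi<c : v ⟨$⟩ʳ i < c
  vi<c = FinP.≤∧≢⇒< vi≤c (λ vi≡c → FinP.<⇒≢ i<p (perm-injective v (trans vi≡c (sym vp≡c))))
  i<r : i < r
  i<r = FinP.≤∧≢⇒< i≤r λ { refl → FinP.<-asym vi<c c<vr }
  u₁ : Perm n
  u₁ = swap v i p
  u₁i≡c : u₁ ⟨$⟩ʳ i ≡ c
  u₁i≡c = trans (swap-left v i p) vp≡c
  u₁i<u₁r : i <[ u₁ ] r
  u₁i<u₁r = subst₂ _<_ (sym u₁i≡c)
    (sym (swap-other v (FinP.<⇒≢ i<r ∘ sym) (FinP.<⇒≢ r<p))) c<vr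

-- The mirror image: c sits in a row p above r; use the south-east witness.
reach-from-above : p < r → v ⟨$⟩ʳ p ≡ c → SE v r c → Reaches v r c
reach-from-above {n} {p = p} {r = r} {v = v} {c = c} p<r vp≡c (k , r≤k , c≤vk)
  with FinP.<-cmp c (v ⟨$⟩ʳ r)
... | tri≈ _ c≡vr _ = v , ε , sym c≡vr
... | tri< c<vr _ _ =
  swap v p r , swap-up v p r p<r (subst (_< v ⟨$⟩ʳ r) (sym vp≡c) c<vr) ,
  trans (swap-right v p r) vp≡c
... | tri> _ _ vr<c =
  swap u₁ r k , swap-up v p k p<k (subst (_< v ⟨$⟩ʳ k) (sym vp≡c) c<vk) ◅◅ swap-up u₁ r k r<k u₁r<u₁k ,
  trans (swap-left u₁ r k) u₁k≡c
  where
  p<k : p < k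
  p<k = ℕ.<-≤-trans p<r r≤k
  c<vk : c < v ⟨$⟩ʳ k
  c<vk = FinP.≤∧≢⇒< c≤vk (λ c≡vk → FinP.<⇒≢ p<k (perm-injective v (trans vp≡c c≡vk)))
  r<k : r < k
  r<k = FinP.≤∧≢⇒< r≤k λ { refl → FinP.<-asym vr<c c<vk }
  u₁ : Perm n
  u₁ = swap v p k
  u₁k≡c : u₁ ⟨$⟩ʳ k ≡ c
  u₁k≡c = trans (swap-right v p k) vp≡c
  u₁r<u₁k : r <[ u₁ ] k
  u₁r<u₁k = subst₂ _<_
    (sym (swap-other v (FinP.<⇒≢ p<r ∘ sym) (FinP.<⇒≢ r<k))) (sym u₁k≡c) vr<c

reach : NW v r c → SE v r c → Reaches v r c
reach {v = v} {r = r} {c = c} nw se with FinP.<-cmp r (v ⟨$⟩ˡ c)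
... | tri< r<p _ _ = reach-from-below r<p (inverseʳ v) nw
... | tri≈ _ r≡p _ = v , ε , trans (cong (v ⟨$⟩ʳ_) r≡p) (inverseʳ v)
... | tri> _ _ p<r = reach-from-above p<r (inverseʳ v) se

AgreesAbove : ℕ → Perm n → Set
AgreesAbove {n} t u = ∀ (s : Fin n) → toℕ s ℕ.< t → u ⟨$⟩ʳ s ≡ opposite s

BelowW₀ : Perm n → Set
BelowW₀ {n} u = ∃ λ (w : Perm n) → w₀ w × u ≤B w

opposite-reverses : {x y : Fin n} → x < y → opposite y < opposite x
opposite-reverses {x = x} {y} x<y =
  subst₂ ℕ._<_ (sym (FinP.opposite-prop y)) (sym (FinP.opposite-prop x))
    (ℕ.∸-monoʳ-< (s≤s x<y) (FinP.toℕ<n y))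

opposite-injective : {x y : Fin n} → opposite x ≡ opposite y → x ≡ y
opposite-injective {x = x} {y} e =
  trans (sym (FinP.opposite-involutive x)) (trans (cong opposite e) (FinP.opposite-involutive y))

-- The rows above T carry the largest values, so row T holds at most w₀(T).
agreement-bounds-next : (T : Fin n) (u : Perm n) → AgreesAbove (toℕ T) u → u ⟨$⟩ʳ T ≤ opposite T
agreement-bounds-next {n} T u agree = ℕ.≮⇒≥ λ oT<uT →
  let s : Fin n
      s = opposite (u ⟨$⟩ʳ T)
      s<T : s < T
      s<T = subst (s <_) (FinP.opposite-involutive T) (opposite-reverses oT<uT)
      us≡uT : u ⟨$⟩ʳ s ≡ u ⟨$⟩ʳ T
      us≡uT = trans (agree s s<T) (FinP.opposite-involutive (u ⟨$⟩ʳ T))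
  in FinP.<⇒≢ s<T (perm-injective u us≡uT)

agreement-extends : (T : Fin n) (u : Perm n) → AgreesAbove (toℕ T) u → u ⟨$⟩ʳ T ≡ opposite T →
  AgreesAbove (suc (toℕ T)) u
agreement-extends T u agree uT≡oT s s<1+T with ℕ.m≤n⇒m<n∨m≡n (ℕ.s≤s⁻¹ s<1+T)
... | inj₁ s<T = agree s s<T
... | inj₂ s≡T with FinP.toℕ-injective s≡T
...   | refl = uT≡oT

-- One more row of w₀ is obtained by at most one Bruhat step: swap row T
-- with the row q holding w₀(T), which lies below T.
agreement-grows : (T : Fin n) {u : Perm n} → AgreesAbove (toℕ T) u →
  ∃ λ (u′ : Perm n) → u ≤B u′ × AgreesAbove (suc (toℕ T)) u′
agreement-grows {n} T {u} agree with FinP.<-cmp T (u ⟨$⟩ˡ opposite T)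
... | tri≈ _ T≡q _ =
  u , ε , agreement-extends T u agree (trans (cong (u ⟨$⟩ʳ_) T≡q) (inverseʳ u))
... | tri> _ _ q<T =
  ⊥-elim (FinP.<⇒≢ q<T (opposite-injective (trans (sym (agree _ q<T)) (inverseʳ u))))
... | tri< T<q _ _ =
  swap u T q , swap-up u T q T<q uT<uq ,
  agreement-extends T (swap u T q) agree′ (trans (swap-left u T q) (inverseʳ u))
  where
  q : Fin n
  q = u ⟨$⟩ˡ opposite T
  uT<uq : T <[ u ] q
  uT<uq = FinP.≤∧≢⇒< (subst (u ⟨$⟩ʳ T ≤_) (sym (inverseʳ u)) (agreement-bounds-next T u agree))
    (FinP.<⇒≢ T<q ∘ perm-injective u)
  agree′ : AgreesAbove (toℕ T) (swap u T q)
  agree′ s s<T =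
    trans (swap-other u (FinP.<⇒≢ s<T) (FinP.<⇒≢ (FinP.<-trans s<T T<q))) (agree s s<T)

fill-rows : ∀ m t → m + t ≡ n → {u : Perm n} → AgreesAbove t u → BelowW₀ u
fill-rows ℕ.zero t t≡n {u} agree =
  u , (λ s → agree s (subst (toℕ s ℕ.<_) (sym t≡n) (FinP.toℕ<n s))) , ε
fill-rows {n} (suc m) t 1+m+t≡n {u} agree
  with agreement-grows (fromℕ< t<n) (subst (λ t → AgreesAbove t u) (sym (FinP.toℕ-fromℕ< t<n)) agree)
  where
  t<n : t ℕ.< n
  t<n = subst (t ℕ.<_) 1+m+t≡n (ℕ.m<n+m t z<s)
... | u′ , u≤u′ , agree′ with fill-rows m (suc t) (trans (ℕ.+-suc m t) 1+m+t≡n)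
                                  (subst (λ t → AgreesAbove (suc t) u′) (FinP.toℕ-fromℕ< _) agree′)
...   | w , w-longest , u′≤w = w , w-longest , u≤u′ ◅◅ u′≤w

below-w₀ : (u : Perm n) → BelowW₀ u
below-w₀ u = fill-rows _ 0 (ℕ.+-identityʳ _) (λ _ ())

Γ-cell : NW v r c → SE v r c → InΓ v r c
Γ-cell nw se with reach nw se
... | u , v≤u , ur≡c with below-w₀ u
...   | w , w-longest , u≤w = u , w , w-longest , v≤u , u≤w , ur≡c

Spread : Perm n → Set
Spread {n} v = ∃ λ (i : Fin n) → ∃ λ (k : Fin n) →
  toℕ i + 2 ℕ.≤ toℕ k × toℕ (v ⟨$⟩ʳ i) + 2 ℕ.≤ toℕ (v ⟨$⟩ʳ k)

data Straddle (v : Perm n) : Set where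
  straddle : {i j k p : Fin n} → i < j → j < k → i <[ v ] p → p <[ v ] k → Straddle v

window-end : (a : Fin n) → toℕ a + 2 ℕ.< n → ∃ λ (a′ : Fin n) → toℕ a′ ≡ toℕ a + 2
window-end a a+2<n = fromℕ< a+2<n , FinP.toℕ-fromℕ< a+2<n

strictly-between : (x y : Fin n) → toℕ x + 2 ℕ.≤ toℕ y → ∃ λ (z : Fin n) → x < z × z < y
strictly-between {n} x y x+2≤y =
  fromℕ< 1+x<n , subst (toℕ x ℕ.<_) (sym z≡1+x) (ℕ.n<1+n _) , subst (ℕ._< toℕ y) (sym z≡1+x) 1+x<y
  where
  1+x<y : suc (toℕ x) ℕ.< toℕ y
  1+x<y = subst (ℕ._≤ toℕ y) (ℕ.+-comm (toℕ x) 2) x+2≤y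
  1+x<n : suc (toℕ x) ℕ.< n
  1+x<n = ℕ.<-trans 1+x<y (FinP.toℕ<n y)
  z≡1+x : toℕ (fromℕ< 1+x<n) ≡ suc (toℕ x)
  z≡1+x = FinP.toℕ-fromℕ< 1+x<n

-- The corners (a , b) and (a+2 , b+2) of a square have witnesses in v.
square⇒spread : HasSquare3 v → Spread v
square⇒spread {v = v} (a , b , a+2<n , b+2<n , cells)
  with window-end a a+2<n | window-end b b+2<n
... | a′ , a′≡a+2 | b′ , b′≡b+2
  with Γ⇒NW (cells a b FinP.≤-refl (ℕ.m≤m+n _ 2) FinP.≤-refl (ℕ.m≤m+n _ 2))
     | Γ⇒SE (cells a′ b′ (subst (toℕ a ℕ.≤_) (sym a′≡a+2) (ℕ.m≤m+n _ 2)) (ℕ.≤-reflexive a′≡a+2)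
                         (subst (toℕ b ℕ.≤_) (sym b′≡b+2) (ℕ.m≤m+n _ 2)) (ℕ.≤-reflexive b′≡b+2))
...   | i , i≤a , vi≤b | k , a′≤k , b′≤vk =
  i , k , ℕ.≤-trans (ℕ.+-monoˡ-≤ 2 i≤a) (subst (ℕ._≤ toℕ k) a′≡a+2 a′≤k) ,
          ℕ.≤-trans (ℕ.+-monoˡ-≤ 2 vi≤b) (subst (ℕ._≤ toℕ (v ⟨$⟩ʳ k)) b′≡b+2 b′≤vk)

-- A spread (i , k) spans the square with corner (i , v_i): every cell has
-- i as north-west and k as south-east witness.
spread⇒square : Spread v → HasSquare3 v
spread⇒square {v = v} (i , k , rows , columns) =
  i , v ⟨$⟩ʳ i , ℕ.≤-<-trans rows (FinP.toℕ<n k) , ℕ.≤-<-trans columns (FinP.toℕ<n (v ⟨$⟩ʳ k)) ,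
  λ r c i≤r r≤i+2 vi≤c c≤vi+2 →
    Γ-cell (i , i≤r , vi≤c) (k , ℕ.≤-trans r≤i+2 rows , ℕ.≤-trans c≤vi+2 columns)

-- The middle row and the middle value of a spread give a straddle.
spread⇒straddle : Spread v → Straddle v
spread⇒straddle {v = v} (i , k , rows , columns)
  with strictly-between i k rows | strictly-between (v ⟨$⟩ʳ i) (v ⟨$⟩ʳ k) columns
... | j , i<j , j<k | m , vi<m , m<vk =
  straddle {p = v ⟨$⟩ˡ m} i<j j<k
    (subst (v ⟨$⟩ʳ i <_) (sym (inverseʳ v)) vi<m) (subst (_< v ⟨$⟩ʳ k) (sym (inverseʳ v)) m<vk)

straddle⇒spread : Straddle v → Spread v
straddle⇒spread (straddle {i} {j} {k} i<j j<k vi<vp vp<vk) =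
  i , k , two-apart i<j j<k , two-apart vi<vp vp<vk

squares-are-straddles : HasSquare3 v ⇔ Straddle v
squares-are-straddles = mk⇔ (spread⇒straddle ∘ square⇒spread) (spread⇒square ∘ straddle⇒spread)

chain-order : (v : Perm n) {ys : Vec (Fin n) k} → Linked (_<[ v ]_) ys →
  ∀ a b → (lookup ys a <[ v ] lookup ys b) ⇔ (a < b)
chain-order v {ys} linked a b = mk⇔ reflect (lookup⁺ ℕ.<-trans linked)
  where
  reflect : lookup ys a <[ v ] lookup ys b → a < b
  reflect va<vb with FinP.<-cmp a b
  ... | tri< a<b _ _ = a<b
  ... | tri≈ _ refl _ = ⊥-elim (ℕ.<-irrefl refl va<vb)
  ... | tri> _ _ b<a = ⊥-elim (ℕ.<-asym va<vb (lookup⁺ ℕ.<-trans linked b<a))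

one-based : Fin k → ℕ
one-based r = suc (toℕ r)

-- An occurrence of the pattern with ranks `ranks`, presented by its rows
-- listed in increasing order of value (byValue): it suffices that these
-- rows increase when read in pattern order and their values along byValue.
occurrence : (v : Perm n) (ranks : Vec (Fin k) k) (byValue : Vec (Fin n) k) →
  Linked _<_ (map (lookup byValue) ranks) → Linked (_<[ v ]_) byValue →
  Contains v (map one-based ranks)
occurrence {n = n} {k = k} v ranks byValue rows-increase values-increase =
  row , (λ a b → lookup⁺ ℕ.<-trans rows-increase) , values-match
  where
  row : Fin k → Fin n
  row = lookup (map (lookup byValue) ranks)
  values-match : ∀ a b → (row a <[ v ] row b) ⇔
    (lookup (map one-based ranks) a ℕ.< lookup (map one-based ranks) b)
  values-match a b
    rewrite lookup-map a (lookup byValue) ranks | lookup-map b (lookup byValue) ranks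
          | lookup-map a one-based ranks | lookup-map b one-based ranks =
    mk⇔ (s<s ∘ Equivalence.to order) (Equivalence.from order ∘ ℕ.s<s⁻¹)
    where
    order : (lookup byValue (lookup ranks a) <[ v ] lookup byValue (lookup ranks b)) ⇔
            (lookup ranks a < lookup ranks b)
    order = chain-order v values-increase (lookup ranks a) (lookup ranks b)

-- The four patterns, with rows x₀ < x₁ < x₂ (< x₃) and values listed in
-- increasing order.
occurrence-123 : (v : Perm n) {x₀ x₁ x₂ : Fin n} → x₀ < x₁ → x₁ < x₂ →
  x₀ <[ v ] x₁ → x₁ <[ v ] x₂ → Contains v (1 ∷ 2 ∷ 3 ∷ [])
occurrence-123 v {x₀} {x₁} {x₂} r₀ r₁ v₀ v₁ =
  occurrence v (0F ∷ 1F ∷ 2F ∷ []) (x₀ ∷ x₁ ∷ x₂ ∷ []) (r₀ ∷ r₁ ∷ [-]) (v₀ ∷ v₁ ∷ [-])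

occurrence-2143 : (v : Perm n) {x₀ x₁ x₂ x₃ : Fin n} → x₀ < x₁ → x₁ < x₂ → x₂ < x₃ →
  x₁ <[ v ] x₀ → x₀ <[ v ] x₃ → x₃ <[ v ] x₂ → Contains v (2 ∷ 1 ∷ 4 ∷ 3 ∷ [])
occurrence-2143 v {x₀} {x₁} {x₂} {x₃} r₀ r₁ r₂ v₀ v₁ v₂ =
  occurrence v (1F ∷ 0F ∷ 3F ∷ 2F ∷ []) (x₁ ∷ x₀ ∷ x₃ ∷ x₂ ∷ [])
    (r₀ ∷ r₁ ∷ r₂ ∷ [-]) (v₀ ∷ v₁ ∷ v₂ ∷ [-])

occurrence-1432 : (v : Perm n) {x₀ x₁ x₂ x₃ : Fin n} → x₀ < x₁ → x₁ < x₂ → x₂ < x₃ →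
  x₀ <[ v ] x₃ → x₃ <[ v ] x₂ → x₂ <[ v ] x₁ → Contains v (1 ∷ 4 ∷ 3 ∷ 2 ∷ [])
occurrence-1432 v {x₀} {x₁} {x₂} {x₃} r₀ r₁ r₂ v₀ v₁ v₂ =
  occurrence v (0F ∷ 3F ∷ 2F ∷ 1F ∷ []) (x₀ ∷ x₃ ∷ x₂ ∷ x₁ ∷ [])
    (r₀ ∷ r₁ ∷ r₂ ∷ [-]) (v₀ ∷ v₁ ∷ v₂ ∷ [-])

occurrence-3214 : (v : Perm n) {x₀ x₁ x₂ x₃ : Fin n} → x₀ < x₁ → x₁ < x₂ → x₂ < x₃ →
  x₂ <[ v ] x₁ → x₁ <[ v ] x₀ → x₀ <[ v ] x₃ → Contains v (3 ∷ 2 ∷ 1 ∷ 4 ∷ [])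
occurrence-3214 v {x₀} {x₁} {x₂} {x₃} r₀ r₁ r₂ v₀ v₁ v₂ =
  occurrence v (2F ∷ 1F ∷ 0F ∷ 3F ∷ []) (x₂ ∷ x₁ ∷ x₀ ∷ x₃ ∷ [])
    (r₀ ∷ r₁ ∷ r₂ ∷ [-]) (v₀ ∷ v₁ ∷ v₂ ∷ [-])

occurrence⇒straddle : (v : Perm n) (π : Vec ℕ k) → Contains v π → (a b c d : Fin k) →
  a < b → b < c → lookup π a ℕ.< lookup π d → lookup π d ℕ.< lookup π c →
  Straddle v
occurrence⇒straddle v π (row , increasing , order) a b c d a<b b<c ad dc =
  straddle (increasing a b a<b) (increasing b c b<c)
    (Equivalence.from (order a d) ad) (Equivalence.from (order d c) dc)

-- Each of 123, 1432 and 3214 straddles: take the entries valued 1, 2, 3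
-- of 123; rows 0 < 1 < 2 and the entry valued 2 (row 3) of 1432; rows
-- 1 < 2 < 3 and the entry valued 3 (row 0) of 3214.
straddle-of-123 : (v : Perm n) → Contains v (1 ∷ 2 ∷ 3 ∷ []) → Straddle v
straddle-of-123 v occ =
  occurrence⇒straddle v (1 ∷ 2 ∷ 3 ∷ []) occ 0F 1F 2F 1F z<s (s<s z<s) (s<s z<s) (s<s (s<s z<s))

straddle-of-1432 : (v : Perm n) → Contains v (1 ∷ 4 ∷ 3 ∷ 2 ∷ []) → Straddle v
straddle-of-1432 v occ =
  occurrence⇒straddle v (1 ∷ 4 ∷ 3 ∷ 2 ∷ []) occ 0F 1F 2F 3F z<s (s<s z<s) (s<s z<s) (s<s (s<s z<s))

straddle-of-3214 : (v : Perm n) → Contains v (3 ∷ 2 ∷ 1 ∷ 4 ∷ []) → Straddle v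
straddle-of-3214 v occ =
  occurrence⇒straddle v (3 ∷ 2 ∷ 1 ∷ 4 ∷ []) occ 1F 2F 3F 0F
    (s<s z<s) (s<s (s<s z<s)) (s<s (s<s z<s)) (s<s (s<s (s<s z<s)))

outside-rows : (v : Perm n) → Avoids v (1 ∷ 2 ∷ 3 ∷ []) → {i k p : Fin n} →
  i <[ v ] p → p <[ v ] k → p < i ⊎ k < p
outside-rows v no123 {i} {k} {p} vi<vp vp<vk with FinP.<-cmp p i | FinP.<-cmp p k
... | tri< p<i _ _ | _ = inj₁ p<i
... | _ | tri> _ _ k<p = inj₂ k<p
... | tri≈ _ refl _ | _ = ⊥-elim (ℕ.<-irrefl refl vi<vp)
... | _ | tri≈ _ refl _ = ⊥-elim (ℕ.<-irrefl refl vp<vk)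
... | tri> _ _ i<p | tri< p<k _ _ = ⊥-elim (no123 (occurrence-123 v i<p p<k vi<vp vp<vk))

outside-values : (v : Perm n) → Avoids v (1 ∷ 2 ∷ 3 ∷ []) → {i j k : Fin n} →
  i < j → j < k → j <[ v ] i ⊎ k <[ v ] j
outside-values v no123 {i} {j} {k} i<j j<k
  with FinP.<-cmp (v ⟨$⟩ʳ j) (v ⟨$⟩ʳ i) | FinP.<-cmp (v ⟨$⟩ʳ j) (v ⟨$⟩ʳ k)
... | tri< vj<vi _ _ | _ = inj₁ vj<vi
... | _ | tri> _ _ vk<vj = inj₂ vk<vj
... | tri≈ _ vj≡vi _ | _ = ⊥-elim (FinP.<⇒≢ i<j (sym (perm-injective v vj≡vi)))
... | _ | tri≈ _ vj≡vk _ = ⊥-elim (FinP.<⇒≢ j<k (perm-injective v vj≡vk))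
... | tri> _ _ vi<vj | tri< vj<vk _ _ = ⊥-elim (no123 (occurrence-123 v i<j j<k vi<vj vj<vk))

straddle-forces-pattern : (v : Perm n) →
  Avoids v (2 ∷ 1 ∷ 4 ∷ 3 ∷ []) → Avoids v (1 ∷ 2 ∷ 3 ∷ []) →
  Avoids v (1 ∷ 4 ∷ 3 ∷ 2 ∷ []) → Avoids v (3 ∷ 2 ∷ 1 ∷ 4 ∷ []) → ¬ Straddle v
straddle-forces-pattern v no2143 no123 no1432 no3214 (straddle i<j j<k vi<vp vp<vk)
  with outside-values v no123 i<j j<k | outside-rows v no123 vi<vp vp<vk
... | inj₁ vj<vi | inj₁ p<i = no3214 (occurrence-3214 v p<i i<j j<k vj<vi vi<vp vp<vk)
... | inj₁ vj<vi | inj₂ k<p = no2143 (occurrence-2143 v i<j j<k k<p vj<vi vi<vp vp<vk)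
... | inj₂ vk<vj | inj₁ p<i = no2143 (occurrence-2143 v p<i i<j j<k vi<vp vp<vk vk<vj)
... | inj₂ vk<vj | inj₂ k<p = no1432 (occurrence-1432 v i<j j<k k<p vi<vp vp<vk vk<vj)

proposition4p2 : (n : ℕ) (v : Perm n) → Avoids v (2 ∷ 1 ∷ 4 ∷ 3 ∷ []) →
    (¬ HasSquare3 v) ⇔
      (Avoids v (1 ∷ 2 ∷ 3 ∷ []) × Avoids v (1 ∷ 4 ∷ 3 ∷ 2 ∷ []) × Avoids v (3 ∷ 2 ∷ 1 ∷ 4 ∷ []))
proposition4p2 n v no2143 = mk⇔ patterns-avoided no-square
  where
  open Equivalence (squares-are-straddles {v = v})
    renaming (to to straddle-of-square; from to square-of-straddle)
  patterns-avoided : ¬ HasSquare3 v →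
    Avoids v (1 ∷ 2 ∷ 3 ∷ []) × Avoids v (1 ∷ 4 ∷ 3 ∷ 2 ∷ []) × Avoids v (3 ∷ 2 ∷ 1 ∷ 4 ∷ [])
  patterns-avoided no-square =
    no-square ∘ square-of-straddle ∘ straddle-of-123 v ,
    no-square ∘ square-of-straddle ∘ straddle-of-1432 v ,
    no-square ∘ square-of-straddle ∘ straddle-of-3214 v
  no-square :
    Avoids v (1 ∷ 2 ∷ 3 ∷ []) × Avoids v (1 ∷ 4 ∷ 3 ∷ 2 ∷ []) × Avoids v (3 ∷ 2 ∷ 1 ∷ 4 ∷ []) →
    ¬ HasSquare3 v
  no-square (no123 , no1432 , no3214) =
    straddle-forces-pattern v no2143 no123 no1432 no3214 ∘ straddle-of-square
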